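{- There is a constant $c>0$ such that for every (sufficiently large) $n$ there exist at least $2^{cn}$ undirected graphs on $n$ vertices that are pairwise homomorphically incomparable (for any two distinct ones $A,B$ there is no homomorphism $A\to B$), yet any two of them are $TT_2$-equivalent (there is a cut-continuous mapping from each to the other).
   Context: Graphs are finite undirected. A cut in a graph is the set of edges between $X$ and $V\setminus X$ for some $X\subseteq V$. A mapping $f:E(G)\to E(H)$ is cut-continuous ($TT_2$) if the preimage under $f$ of every cut of $H$ is a cut of $G$ (equivalently, $f$ is ${\mathbb Z}_2$-tension-continuous). Graphs $A,B$ are $TT_2$-equivalent if there are $TT_2$ mappings $E(A)\to E(B)$ and $E(B)\to E(A)$. -}

module Defs where

open import Data.Nat using (ℕ; _<_)
open import Data.Fin using (Fin; toℕ)
open import Data.Bool using (Bool; true; false; _xor_)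
open import Data.Product using (Σ; _×_; _,_; proj₁; proj₂)
open import Relation.Binary.PropositionalEquality using (_≡_)
open import Relation.Nullary using (¬_)

record Graph (n : ℕ) : Set where
  field
    adj    : Fin n → Fin n → Bool
    sym    : ∀ u v → adj u v ≡ adj v u
    irrefl : ∀ u → adj u u ≡ false
open Graph public

Hom : ∀ {n m} → Graph n → Graph m → Set
Hom {n} {m} G H = Σ (Fin n → Fin m) λ f → ∀ u v → adj G u v ≡ true → adj H (f u) (f v) ≡ true

-- An (undirected) edge {u,v} of G, represented canonically with toℕ u < toℕ v.
Edge : ∀ {n} → Graph n → Set
Edge {n} G = Σ (Fin n × Fin n) λ p → (toℕ (proj₁ p) < toℕ (proj₂ p)) × (adj G (proj₁ p) (proj₂ p) ≡ true)

inCut : ∀ {n} (G : Graph n) → (Fin n → Bool) → Edge G → Bool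
inCut G X ((u , v) , _) = X u xor X v

CutContinuous : ∀ {n m} (G : Graph n) (H : Graph m) → (Edge G → Edge H) → Set
CutContinuous {n} {m} G H f =
  ∀ (Y : Fin m → Bool) → Σ (Fin n → Bool) λ X → ∀ (e : Edge G) → inCut H Y (f e) ≡ inCut G X e

TT₂ : ∀ {n m} → Graph n → Graph m → Set
TT₂ G H = Σ (Edge G → Edge H) λ f → CutContinuous G H f

TT₂-equivalent : ∀ {n m} → Graph n → Graph m → Set
TT₂-equivalent G H = TT₂ G H × TT₂ H G

module Submission where

-- For a word w of m bits let L = 13 + 8m.  The graph Γ w consists of an odd cycle C_L on the rim
-- vertices, a hub adjacent to the whole rim, a twin of each rim vertex a adjacent to the two rim
-- neighbours of a, for each k an altHub adjacent to twin k and to every rim vertex except k, and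
-- label edges between twins: the markers {1,6}, {1,8} and, for the j-th bit, {p, p+3} with
-- p = 11 + 8j + 4wⱼ.  Every Γ w is properly coloured by ℤ₂² and contains a triangle; sending each
-- edge to the triangle edge indexed by the colour difference of its ends is cut-continuous, so
-- all Γ w are TT₂-equivalent.  Conversely, every edge in the neighbourhood of a non-hub vertex has
-- exactly one hub end, so a homomorphism Γ v → Γ w maps the centres of odd wheels to hubs.  Hence
-- it acts on the rim as a rotation or reflection of C_L and carries the twins along; the markers
-- force the identity, and then the bit edges force v = w.  Taking m ≈ n/48 (and padding with
-- isolated vertices) gives 2^m ≥ 2^(n/48) pairwise incomparable graphs on n vertices.

open import Defs hiding (sym)
open import Data.Nat using (ℕ; suc; _*_; _^_; _≤_)
open import Data.Fin using (Fin)
open import Data.Product using (Σ; _×_)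
open import Relation.Binary.PropositionalEquality using (_≡_)
open import Relation.Nullary using (¬_)

open import Algebra.Bundles using (CommutativeRing)
import Algebra.Properties.CommutativeSemigroup as CommSemigroupProperties
open import Data.Bool using (Bool; true; false; not; _∧_; _∨_; _xor_; T; if_then_else_)
open import Data.Bool.Properties
  using (xor-∧-commutativeRing; ∧-distribʳ-xor; xor-comm; xor-same; xor-identityʳ; ¬-not; not-¬)
import Data.Bool.Properties as BP
open import Data.Empty using (⊥; ⊥-elim)
open import Data.Fin using (toℕ; splitAt; _↑ˡ_; _↑ʳ_; fromℕ<; finToFun; funToFin; combine)
import Data.Fin.Properties as FP
open import Data.Integer as Z using (ℤ; +_; -[1+_]; +[1+_]; ∣_∣; 0ℤ; 1ℤ; -1ℤ)
import Data.Integer.Properties as ZP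
open import Data.Integer.Tactic.RingSolver using (solve-∀)
open import Data.Nat using (zero; _+_; _∸_; _<_; z≤n; s≤s; _≡ᵇ_; _<ᵇ_; _/_; _%_)
open import Data.Nat.DivMod using (n%n≡0; m<n⇒m%n≡m; m≡m%n+[m/n]*n; m%n<n; /-monoˡ-≤)
import Data.Nat.Properties as NP
import Data.Nat.Tactic.RingSolver as NatSolver
open import Data.Product using (_,_; proj₁; proj₂)
open import Data.Sum using (_⊎_; inj₁; inj₂)
open import Data.Unit using (⊤; tt)
open import Function using (_∘_; case_of_)
open import Relation.Binary.PropositionalEquality
  using (_≢_; refl; sym; trans; cong; cong₂; subst; subst₂; module ≡-Reasoning)
open import Relation.Nullary using (contradiction; yes; no)

≡ᵇ-true⇒≡ : ∀ {m n} → (m ≡ᵇ n) ≡ true → m ≡ n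
≡ᵇ-true⇒≡ {m} {n} e = NP.≡ᵇ⇒≡ m n (subst T (sym e) _)

≡⇒≡ᵇ-true : ∀ {m n} → m ≡ n → (m ≡ᵇ n) ≡ true
≡⇒≡ᵇ-true {m} {n} refl with m ≡ᵇ m | NP.≡⇒≡ᵇ m m refl
... | true | _ = refl

≢⇒≡ᵇ-false : ∀ {m n} → m ≢ n → (m ≡ᵇ n) ≡ false
≢⇒≡ᵇ-false {m} {n} m≢n with m ≡ᵇ n in e
... | true = contradiction (≡ᵇ-true⇒≡ e) m≢n
... | false = refl

∨-true : ∀ {a b} → (a ∨ b) ≡ true → a ≡ true ⊎ b ≡ true
∨-true {true} _ = inj₁ refl
∨-true {false} b = inj₂ b

∨-introˡ : ∀ {a b} → a ≡ true → (a ∨ b) ≡ true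
∨-introˡ refl = refl

∨-introʳ : ∀ {a b} → b ≡ true → (a ∨ b) ≡ true
∨-introʳ {true} _ = refl
∨-introʳ {false} b = b

∧-true : ∀ {a b} → (a ∧ b) ≡ true → a ≡ true × b ≡ true
∧-true {true} {true} _ = refl , refl

≢-≢⇒≡ : ∀ {x y z : Bool} → x ≢ y → y ≢ z → x ≡ z
≢-≢⇒≡ x≢y y≢z = trans (¬-not x≢y) (sym (¬-not (λ z≡y → y≢z (sym z≡y))))

-- Cut-continuous maps into a triangle

xor-interchange : ∀ a b c d → (a xor b) xor (c xor d) ≡ (a xor c) xor (b xor d)
xor-interchange = CommSemigroupProperties.interchange
  (CommutativeRing.+-commutativeSemigroup xor-∧-commutativeRing)

xor-cancelˡ : ∀ a b c → (a xor b) xor (a xor c) ≡ b xor c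
xor-cancelˡ a b c = trans (xor-interchange a b a c) (cong (_xor (b xor c)) (xor-same a))

record Triangle {n : ℕ} (H : Graph n) : Set where
  field
    t₀ t₁ t₂ : Fin n
    t₀t₁ : adj H t₀ t₁ ≡ true
    t₀t₂ : adj H t₀ t₂ ≡ true
    t₁t₂ : adj H t₁ t₂ ≡ true

module _ {n : ℕ} (H : Graph n) where

  edge-between : ∀ u v → adj H u v ≡ true → Edge H
  edge-between u v uv with toℕ u NP.<? toℕ v
  ... | yes u<v = (u , v) , u<v , uv
  ... | no u≮v = (v , u) , v<u , trans (Graph.sym H v u) uv
    where
    u≢v : toℕ u ≢ toℕ v
    u≢v u≡v with () ← trans (sym uv) (subst (λ w → adj H u w ≡ false) (FP.toℕ-injective u≡v) (irrefl H u))
    v<u : toℕ v < toℕ u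
    v<u = NP.≤∧≢⇒< (NP.≮⇒≥ u≮v) (λ v≡u → u≢v (sym v≡u))

  inCut-edge-between : ∀ Y u v uv → inCut H Y (edge-between u v uv) ≡ Y u xor Y v
  inCut-edge-between Y u v uv with toℕ u NP.<? toℕ v
  ... | yes _ = refl
  ... | no _ = xor-comm (Y v) (Y u)

-- An edge whose ends get colours differing by d ∈ ℤ₂² ∖ {0} goes to the triangle edge labelled d;
-- the preimage of the cut of Y is then the cut of the linear functional κ ↦ κ · (Y t₀ + Y t₁, Y t₀ + Y t₂).
TT₂-into-triangle : ∀ {n n′} (G : Graph n) (H : Graph n′) (κ : Fin n → Bool × Bool) →
  (∀ u v → adj G u v ≡ true → κ u ≢ κ v) → Triangle H → TT₂ G H
TT₂-into-triangle {n} {n′} G H κ proper T = f , continuous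
  where
  open Triangle T

  κ₁ κ₂ : Fin n → Bool
  κ₁ = proj₁ ∘ κ
  κ₂ = proj₂ ∘ κ

  triangle-edge : Bool → Bool → Edge H
  triangle-edge true false = edge-between H t₀ t₁ t₀t₁
  triangle-edge false true = edge-between H t₀ t₂ t₀t₂
  triangle-edge true true = edge-between H t₁ t₂ t₁t₂
  triangle-edge false false = edge-between H t₀ t₁ t₀t₁

  f : Edge G → Edge H
  f ((u , v) , _) = triangle-edge (κ₁ u xor κ₁ v) (κ₂ u xor κ₂ v)

  module _ (Y : Fin n′ → Bool) where
    y₁ y₂ : Bool
    y₁ = Y t₀ xor Y t₁
    y₂ = Y t₀ xor Y t₂

    X : Fin n → Bool
    X v = (κ₁ v ∧ y₁) xor (κ₂ v ∧ y₂)

    inCut-triangle-edge : ∀ d₁ d₂ → ¬ (d₁ ≡ false × d₂ ≡ false) →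
      inCut H Y (triangle-edge d₁ d₂) ≡ (d₁ ∧ y₁) xor (d₂ ∧ y₂)
    inCut-triangle-edge true false _ = trans (inCut-edge-between H Y t₀ t₁ t₀t₁) (sym (xor-identityʳ y₁))
    inCut-triangle-edge false true _ = inCut-edge-between H Y t₀ t₂ t₀t₂
    inCut-triangle-edge true true _ = trans (inCut-edge-between H Y t₁ t₂ t₁t₂) (sym (xor-cancelˡ (Y t₀) (Y t₁) (Y t₂)))
    inCut-triangle-edge false false d≢0 = ⊥-elim (d≢0 (refl , refl))

    X-linear : ∀ u v → X u xor X v ≡ ((κ₁ u xor κ₁ v) ∧ y₁) xor ((κ₂ u xor κ₂ v) ∧ y₂)
    X-linear u v = begin
      X u xor X v
        ≡⟨ xor-interchange (κ₁ u ∧ y₁) (κ₂ u ∧ y₂) (κ₁ v ∧ y₁) (κ₂ v ∧ y₂) ⟩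
      ((κ₁ u ∧ y₁) xor (κ₁ v ∧ y₁)) xor ((κ₂ u ∧ y₂) xor (κ₂ v ∧ y₂))
        ≡⟨ cong₂ _xor_ (∧-distribʳ-xor y₁ (κ₁ u) (κ₁ v)) (∧-distribʳ-xor y₂ (κ₂ u) (κ₂ v)) ⟨
      ((κ₁ u xor κ₁ v) ∧ y₁) xor ((κ₂ u xor κ₂ v) ∧ y₂)
        ∎
      where open ≡-Reasoning

  continuous : CutContinuous G H f
  continuous Y = X Y , λ { ((u , v) , _ , uv) →
    trans (inCut-triangle-edge Y (κ₁ u xor κ₁ v) (κ₂ u xor κ₂ v)
             (λ { (d₁ , d₂) → proper u v uv (cong₂ _,_ (xor-≡-false d₁) (xor-≡-false d₂)) }))
          (sym (X-linear Y u v)) }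
    where
    xor-≡-false : ∀ {a b} → a xor b ≡ false → a ≡ b
    xor-≡-false {true} {true} _ = refl
    xor-≡-false {false} {false} _ = refl

-- Congruence modulo n

infix 4 _≡_mod_

record _≡_mod_ (x y : ℤ) (n : ℕ) : Set where
  constructor _,_
  field
    quotient : ℤ
    ≡+quotient : x ≡ y Z.+ quotient Z.* + n

module _ {n : ℕ} where

  ≡-mod-reflexive : ∀ {x y} → x ≡ y → x ≡ y mod n
  ≡-mod-reflexive {x} refl = 0ℤ , lemma x (+ n)
    where
    lemma : ∀ x n → x ≡ x Z.+ 0ℤ Z.* n
    lemma = solve-∀

  ≡-mod-refl : ∀ {x} → x ≡ x mod n
  ≡-mod-refl = ≡-mod-reflexive refl

  ≡-mod-sym : ∀ {x y} → x ≡ y mod n → y ≡ x mod n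
  ≡-mod-sym {x} {y} (q , refl) = Z.- q , lemma y q (+ n)
    where
    lemma : ∀ y q n → y ≡ (y Z.+ q Z.* n) Z.+ Z.- q Z.* n
    lemma = solve-∀

  ≡-mod-trans : ∀ {x y z} → x ≡ y mod n → y ≡ z mod n → x ≡ z mod n
  ≡-mod-trans {z = z} (q , refl) (r , refl) = q Z.+ r , lemma z q r (+ n)
    where
    lemma : ∀ z q r n → (z Z.+ r Z.* n) Z.+ q Z.* n ≡ z Z.+ (q Z.+ r) Z.* n
    lemma = solve-∀

  ≡-mod-+ : ∀ {x y x′ y′} → x ≡ y mod n → x′ ≡ y′ mod n → x Z.+ x′ ≡ y Z.+ y′ mod n
  ≡-mod-+ {y = y} {y′ = y′} (q , refl) (r , refl) = q Z.+ r , lemma y y′ q r (+ n)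
    where
    lemma : ∀ y y′ q r n → (y Z.+ q Z.* n) Z.+ (y′ Z.+ r Z.* n) ≡ (y Z.+ y′) Z.+ (q Z.+ r) Z.* n
    lemma = solve-∀

  ≡-mod-+ʳ : ∀ {x y} z → x ≡ y mod n → x Z.+ z ≡ y Z.+ z mod n
  ≡-mod-+ʳ z x≡y = ≡-mod-+ x≡y (≡-mod-refl {z})

  ≡-mod-neg : ∀ {x y} → x ≡ y mod n → Z.- x ≡ Z.- y mod n
  ≡-mod-neg {y = y} (q , refl) = Z.- q , lemma y q (+ n)
    where
    lemma : ∀ y q n → Z.- (y Z.+ q Z.* n) ≡ Z.- y Z.+ Z.- q Z.* n
    lemma = solve-∀

  ≡-mod-cancelˡ : ∀ x {y z} → x Z.+ y ≡ x Z.+ z mod n → y ≡ z mod n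
  ≡-mod-cancelˡ x {y} {z} x+y≡x+z = ≡-mod-trans (≡-mod-reflexive (lemma x y))
    (≡-mod-trans (≡-mod-+ʳ (Z.- x) x+y≡x+z) (≡-mod-reflexive (sym (lemma x z))))
    where
    lemma : ∀ x y → y ≡ (x Z.+ y) Z.+ Z.- x
    lemma = solve-∀

  n≡0-mod : + n ≡ 0ℤ mod n
  n≡0-mod = 1ℤ , lemma (+ n)
    where
    lemma : ∀ n → n ≡ 0ℤ Z.+ 1ℤ Z.* n
    lemma = solve-∀

  multiple-of-n-smaller-than-n : ∀ q → ∣ q Z.* + n ∣ < n → q ≡ 0ℤ
  multiple-of-n-smaller-than-n (+ zero) _ = refl
  multiple-of-n-smaller-than-n +[1+ q ] qn<n =
    contradiction (subst (n ≤_) (sym (ZP.abs-* +[1+ q ] (+ n))) (NP.m≤n*m n (suc q))) (NP.<⇒≱ qn<n)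
  multiple-of-n-smaller-than-n -[1+ q ] qn<n =
    contradiction (subst (n ≤_) (sym (ZP.abs-* -[1+ q ] (+ n))) (NP.m≤n*m n (suc q))) (NP.<⇒≱ qn<n)

  ≡-mod⇒≡ : ∀ {x y} → x ≡ y mod n → ∣ x Z.- y ∣ < n → x ≡ y
  ≡-mod⇒≡ {x} {y} (q , refl) ∣x-y∣<n = ZP.i-j≡0⇒i≡j x y (begin
    x Z.- y     ≡⟨ lemma y q (+ n) ⟩
    q Z.* + n   ≡⟨ cong (Z._* + n) (multiple-of-n-smaller-than-n q (subst (λ d → ∣ d ∣ < n) (lemma y q (+ n)) ∣x-y∣<n)) ⟩
    0ℤ          ∎)
    where
    open ≡-Reasoning
    lemma : ∀ y q n → (y Z.+ q Z.* n) Z.- y ≡ q Z.* n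
    lemma = solve-∀

  +≡+-mod⇒≡ : ∀ {a b} → a < n → b < n → + a ≡ + b mod n → a ≡ b
  +≡+-mod⇒≡ {a} {b} a<n b<n a≡b = ZP.+-injective (≡-mod⇒≡ a≡b (subst (λ d → ∣ d ∣ < n) (sym (ZP.m-n≡m⊖n a b))
    (NP.≤-<-trans (ZP.∣m⊝n∣≤m⊔n a b) (NP.⊔-lub a<n b<n))))

  ≡-mod-cancelʳ : ∀ {x y} z → x Z.+ z ≡ y Z.+ z mod n → x ≡ y mod n
  ≡-mod-cancelʳ {x} {y} z x+z≡y+z = ≡-mod-cancelˡ z
    (≡-mod-trans (≡-mod-reflexive (ZP.+-comm z x)) (≡-mod-trans x+z≡y+z (≡-mod-reflexive (ZP.+-comm y z))))

  ≡-mod-shift : ∀ x d {y} → y ≡ x Z.+ d mod n → y Z.- x ≡ d mod n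
  ≡-mod-shift x d y≡x+d = ≡-mod-trans (≡-mod-+ʳ (Z.- x) y≡x+d) (≡-mod-reflexive (lemma x d))
    where
    lemma : ∀ x d → (x Z.+ d) Z.- x ≡ d
    lemma = solve-∀

  ≡-mod-difference : ∀ c u v {x y} → x ≡ c Z.+ u mod n → y ≡ c Z.+ v mod n → y Z.- x ≡ v Z.- u mod n
  ≡-mod-difference c u v x≡c+u y≡c+v =
    ≡-mod-trans (≡-mod-+ y≡c+v (≡-mod-neg x≡c+u)) (≡-mod-reflexive (lemma c u v))
    where
    lemma : ∀ c u v → (c Z.+ v) Z.+ Z.- (c Z.+ u) ≡ v Z.- u
    lemma = solve-∀

-- Sums of signs and closed walks on an odd cycle

⟦_⟧ : Bool → ℤ
⟦ true ⟧ = 1ℤ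
⟦ false ⟧ = -1ℤ

⟦not⟧ : ∀ β → ⟦ not β ⟧ ≡ Z.- ⟦ β ⟧
⟦not⟧ true = refl
⟦not⟧ false = refl

∣⟦⟧∣≡1 : ∀ β → ∣ ⟦ β ⟧ ∣ ≡ 1
∣⟦⟧∣≡1 true = refl
∣⟦⟧∣≡1 false = refl

∣⟦⟧*n∣≡n : ∀ β n → ∣ ⟦ β ⟧ Z.* + n ∣ ≡ n
∣⟦⟧*n∣≡n β n = trans (ZP.abs-* ⟦ β ⟧ (+ n)) (trans (cong (_* n) (∣⟦⟧∣≡1 β)) (NP.*-identityˡ n))

signed-sum : (ℕ → Bool) → ℕ → ℤ
signed-sum σ zero = 0ℤ
signed-sum σ (suc k) = signed-sum σ k Z.+ ⟦ σ k ⟧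

module _ (σ : ℕ → Bool) where

  ∣signed-sum∣≤ : ∀ k → ∣ signed-sum σ k ∣ ≤ k
  ∣signed-sum∣≤ zero = z≤n
  ∣signed-sum∣≤ (suc k) = begin
    ∣ signed-sum σ k Z.+ ⟦ σ k ⟧ ∣          ≤⟨ ZP.∣i+j∣≤∣i∣+∣j∣ (signed-sum σ k) ⟦ σ k ⟧ ⟩
    ∣ signed-sum σ k ∣ + ∣ ⟦ σ k ⟧ ∣        ≡⟨ cong (λ x → ∣ signed-sum σ k ∣ + x) (∣⟦⟧∣≡1 (σ k)) ⟩
    ∣ signed-sum σ k ∣ + 1                  ≤⟨ NP.+-monoˡ-≤ 1 (∣signed-sum∣≤ k) ⟩
    k + 1                                   ≡⟨ NP.+-comm k 1 ⟩
    suc k                                   ∎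
    where open NP.≤-Reasoning

  signed-sum-parity : ∀ k → Σ ℤ λ t → signed-sum σ k Z.+ + k ≡ t Z.+ t
  signed-sum-parity zero = 0ℤ , refl
  signed-sum-parity (suc k) with signed-sum-parity k | σ k
  ... | t , s+k≡2t | true = t Z.+ 1ℤ , (begin
    (signed-sum σ k Z.+ 1ℤ) Z.+ + suc k  ≡⟨ cong (λ x → (signed-sum σ k Z.+ 1ℤ) Z.+ x) (ZP.pos-+ 1 k) ⟩
    (signed-sum σ k Z.+ 1ℤ) Z.+ (1ℤ Z.+ + k) ≡⟨ regroup (signed-sum σ k) (+ k) ⟩
    (signed-sum σ k Z.+ + k) Z.+ (1ℤ Z.+ 1ℤ) ≡⟨ cong (Z._+ (1ℤ Z.+ 1ℤ)) s+k≡2t ⟩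
    (t Z.+ t) Z.+ (1ℤ Z.+ 1ℤ)             ≡⟨ regroup′ t ⟩
    (t Z.+ 1ℤ) Z.+ (t Z.+ 1ℤ)             ∎)
    where
    open ≡-Reasoning
    regroup : ∀ s k → (s Z.+ 1ℤ) Z.+ (1ℤ Z.+ k) ≡ (s Z.+ k) Z.+ (1ℤ Z.+ 1ℤ)
    regroup = solve-∀
    regroup′ : ∀ t → (t Z.+ t) Z.+ (1ℤ Z.+ 1ℤ) ≡ (t Z.+ 1ℤ) Z.+ (t Z.+ 1ℤ)
    regroup′ = solve-∀
  ... | t , s+k≡2t | false = t , trans (cong (λ x → (signed-sum σ k Z.+ -1ℤ) Z.+ x) (ZP.pos-+ 1 k))
                                  (trans (regroup (signed-sum σ k) (+ k)) s+k≡2t)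
    where
    regroup : ∀ s k → (s Z.+ -1ℤ) Z.+ (1ℤ Z.+ k) ≡ s Z.+ k
    regroup = solve-∀

  signed-sum-constant : ∀ β k → (∀ a → a < k → σ a ≡ β) → signed-sum σ k ≡ ⟦ β ⟧ Z.* + k
  signed-sum-constant β zero _ = sym (ZP.*-zeroʳ ⟦ β ⟧)
  signed-sum-constant β (suc k) σ≡β = begin
    signed-sum σ k Z.+ ⟦ σ k ⟧
      ≡⟨ cong₂ Z._+_ (signed-sum-constant β k (λ a a<k → σ≡β a (NP.m<n⇒m<1+n a<k))) (cong ⟦_⟧ (σ≡β k (NP.n<1+n k))) ⟩
    ⟦ β ⟧ Z.* + k Z.+ ⟦ β ⟧              ≡⟨ regroup ⟦ β ⟧ (+ k) ⟩
    ⟦ β ⟧ Z.* (1ℤ Z.+ + k)               ≡⟨ cong (⟦ β ⟧ Z.*_) (sym (ZP.pos-+ 1 k)) ⟩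
    ⟦ β ⟧ Z.* + suc k                    ∎
    where
    open ≡-Reasoning
    regroup : ∀ e k → e Z.* k Z.+ e ≡ e Z.* (1ℤ Z.+ k)
    regroup = solve-∀

  signed-sum-previous : ∀ {x} k → signed-sum σ (suc k) ≡ x → signed-sum σ k ≡ x Z.- ⟦ σ k ⟧
  signed-sum-previous k refl = lemma (signed-sum σ k) ⟦ σ k ⟧
    where
    lemma : ∀ s g → s ≡ (s Z.+ g) Z.- g
    lemma = solve-∀

  signed-sum-last : ∀ β k → signed-sum σ (suc k) ≡ ⟦ β ⟧ Z.* + suc k →
    σ k ≡ β × signed-sum σ k ≡ ⟦ β ⟧ Z.* + k
  signed-sum-last β k sum≡ with σ k BP.≟ β
  ... | yes σk≡β = σk≡β , (begin
    signed-sum σ k                              ≡⟨ signed-sum-previous k sum≡ ⟩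
    ⟦ β ⟧ Z.* + suc k Z.- ⟦ σ k ⟧               ≡⟨ cong₂ (λ x y → ⟦ β ⟧ Z.* x Z.- ⟦ y ⟧) (ZP.pos-+ 1 k) σk≡β ⟩
    ⟦ β ⟧ Z.* (1ℤ Z.+ + k) Z.- ⟦ β ⟧            ≡⟨ lemma ⟦ β ⟧ (+ k) ⟩
    ⟦ β ⟧ Z.* + k                               ∎)
    where
    open ≡-Reasoning
    lemma : ∀ e k → e Z.* (1ℤ Z.+ k) Z.- e ≡ e Z.* k
    lemma = solve-∀
  ... | no σk≢β = contradiction (∣signed-sum∣≤ k) (NP.<⇒≱ (subst (k <_) (sym ∣s∣≡) (s≤s (NP.n≤1+n k))))
    where
    open ≡-Reasoning
    lemma : ∀ e k → e Z.* (1ℤ Z.+ k) Z.- Z.- e ≡ e Z.* (+ 2 Z.+ k)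
    lemma = solve-∀
    ∣s∣≡ : ∣ signed-sum σ k ∣ ≡ suc (suc k)
    ∣s∣≡ = begin
      ∣ signed-sum σ k ∣                              ≡⟨ cong ∣_∣ (signed-sum-previous k sum≡) ⟩
      ∣ ⟦ β ⟧ Z.* + suc k Z.- ⟦ σ k ⟧ ∣
        ≡⟨ cong₂ (λ x y → ∣ ⟦ β ⟧ Z.* x Z.- y ∣) (ZP.pos-+ 1 k) (trans (cong ⟦_⟧ (¬-not σk≢β)) (⟦not⟧ β)) ⟩
      ∣ ⟦ β ⟧ Z.* (1ℤ Z.+ + k) Z.- Z.- ⟦ β ⟧ ∣
        ≡⟨ cong ∣_∣ (trans (lemma ⟦ β ⟧ (+ k)) (cong (⟦ β ⟧ Z.*_) (sym (ZP.pos-+ 2 k)))) ⟩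
      ∣ ⟦ β ⟧ Z.* + suc (suc k) ∣                     ≡⟨ ∣⟦⟧*n∣≡n β (suc (suc k)) ⟩
      suc (suc k)                                     ∎

  signed-sum-extremal : ∀ β k → signed-sum σ k ≡ ⟦ β ⟧ Z.* + k → ∀ a → a < k → σ a ≡ β
  signed-sum-extremal β (suc k) sum≡ a a<1+k with signed-sum-last β k sum≡ | NP.m<1+n⇒m<n∨m≡n a<1+k
  ... | σk≡β , _ | inj₂ refl = σk≡β
  ... | _ , sum≡′ | inj₁ a<k = signed-sum-extremal β k sum≡′ a a<k

even≢odd : ∀ m ℓ → m + m ≢ suc (ℓ + ℓ)
even≢odd zero ℓ ()
even≢odd (suc m) zero eq with () ← trans (sym (NP.+-suc m m)) (NP.suc-injective eq)
even≢odd (suc m) (suc ℓ) eq = even≢odd m ℓ (NP.suc-injective (begin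
  suc (m + m)       ≡⟨ sym (NP.+-suc m m) ⟩
  m + suc m         ≡⟨ NP.suc-injective eq ⟩
  suc (ℓ + suc ℓ)   ≡⟨ cong suc (NP.+-suc ℓ ℓ) ⟩
  suc (suc (ℓ + ℓ)) ∎))
  where open ≡-Reasoning

module OddCycle (h : ℕ) where

  ℓ L : ℕ
  ℓ = suc h
  L = suc (ℓ + ℓ)

  arc : ℕ → ℕ → Bool
  arc a b = (suc a ≡ᵇ b) ∨ ((b ≡ᵇ 0) ∧ (suc a ≡ᵇ L))

  adjCycle : ℕ → ℕ → Bool
  adjCycle a b = arc a b ∨ arc b a

  adjCycle-sym : ∀ a b → adjCycle a b ≡ adjCycle b a
  adjCycle-sym a b = BP.∨-comm (arc a b) (arc b a)

  adjCycle-suc : ∀ a → adjCycle a (suc a) ≡ true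
  adjCycle-suc a rewrite ≡⇒≡ᵇ-true (refl {x = suc a}) = refl

  adjCycle-wrap : adjCycle (ℓ + ℓ) 0 ≡ true
  adjCycle-wrap rewrite ≡⇒≡ᵇ-true (refl {x = L}) = refl

  adjCycle-irrefl : ∀ a → adjCycle a a ≡ false
  adjCycle-irrefl zero = refl
  adjCycle-irrefl (suc a) rewrite ≢⇒≡ᵇ-false (NP.1+n≢n {a}) = refl

  arc-step : ∀ {a b} → arc a b ≡ true → + b ≡ + a Z.+ 1ℤ mod L
  arc-step {a} {b} a→b with suc a ≡ᵇ b in e
  ... | true = ≡-mod-reflexive (trans (cong +_ (sym (≡ᵇ-true⇒≡ e))) (trans (ZP.pos-+ 1 a) (ZP.+-comm 1ℤ (+ a))))
  ... | false with b≡0 , 1+a≡L ← ∧-true {b ≡ᵇ 0} a→b with refl ← ≡ᵇ-true⇒≡ {b} {0} b≡0 =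
    ≡-mod-sym (≡-mod-trans (≡-mod-reflexive a+1≡L) n≡0-mod)
    where
    a+1≡L : + a Z.+ 1ℤ ≡ + L
    a+1≡L = trans (ZP.+-comm (+ a) 1ℤ) (trans (sym (ZP.pos-+ 1 a)) (cong +_ (≡ᵇ-true⇒≡ 1+a≡L)))

  adjCycle-step : ∀ {a b} → adjCycle a b ≡ true → + b ≡ + a Z.+ ⟦ arc a b ⟧ mod L
  adjCycle-step {a} {b} a~b with arc a b in e
  ... | true = arc-step e
  ... | false = ≡-mod-trans (≡-mod-reflexive (lemma (+ b))) (≡-mod-+ʳ -1ℤ (≡-mod-sym (arc-step {b} {a} a~b)))
    where
    lemma : ∀ b → b ≡ (b Z.+ 1ℤ) Z.+ -1ℤ
    lemma = solve-∀

  odd-cycle-not-bipartite : (col : ℕ → Bool) →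
    (∀ a b → a < L → b < L → adjCycle a b ≡ true → col a ≢ col b) → ⊥
  odd-cycle-not-bipartite col proper = proper (ℓ + ℓ) 0 (NP.n<1+n _) (s≤s z≤n) adjCycle-wrap (even-vertices ℓ (NP.n<1+n _))
    where
    even-vertices : ∀ k → k + k < L → col (k + k) ≡ col 0
    even-vertices zero _ = refl
    even-vertices (suc k) 2k+2<L rewrite NP.+-suc k k =
      trans (sym (≢-≢⇒≡ (proper _ _ 2k<L 2k+1<L (adjCycle-suc (k + k))) (proper _ _ 2k+1<L 2k+2<L (adjCycle-suc (suc (k + k))))))
            (even-vertices k 2k<L)
      where
      2k+1<L : suc (k + k) < L
      2k+1<L = NP.<-trans (NP.n<1+n _) 2k+2<L
      2k<L : k + k < L
      2k<L = NP.<-trans (NP.n<1+n _) 2k+1<L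

  L≢t+t : ∀ t → + L ≢ t Z.+ t
  L≢t+t (+ u) L≡2u = even≢odd u ℓ (sym (ZP.+-injective (trans L≡2u (sym (ZP.pos-+ u u)))))
  L≢t+t -[1+ u ] ()

  full-turn : ∀ x t → x ≡ 0ℤ mod L → ∣ x ∣ ≤ L → x Z.+ + L ≡ t Z.+ t → Σ Bool λ β → x ≡ ⟦ β ⟧ Z.* + L
  full-turn x t (q , refl) ∣x∣≤L x+L≡2t = turns q (subst (λ y → ∣ y ∣ ≤ L) (ZP.+-identityˡ (q Z.* + L)) ∣x∣≤L)
    (trans (cong (λ y → y Z.+ + L) (sym (ZP.+-identityˡ (q Z.* + L)))) x+L≡2t)
    where
    L<2+q*L : ∀ q → L < suc (suc q) * L
    L<2+q*L q = NP.m<m+n L (s≤s z≤n)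
    turns : ∀ q → ∣ q Z.* + L ∣ ≤ L → q Z.* + L Z.+ + L ≡ t Z.+ t → Σ Bool λ β → 0ℤ Z.+ q Z.* + L ≡ ⟦ β ⟧ Z.* + L
    turns (+ 0) _ L≡2t = contradiction (trans (cong (λ y → y Z.+ + L) (sym (ZP.*-zeroˡ (+ L)))) L≡2t) (L≢t+t t)
    turns (+ 1) _ _ = true , refl
    turns -[1+ 0 ] _ _ = false , refl
    turns +[1+ suc q ] ∣qL∣≤L _ = contradiction ∣qL∣≤L (NP.<⇒≱ (subst (L <_) (sym (ZP.abs-* +[1+ suc q ] (+ L))) (L<2+q*L q)))
    turns -[1+ suc q ] ∣qL∣≤L _ = contradiction ∣qL∣≤L (NP.<⇒≱ (subst (L <_) (sym (ZP.abs-* -[1+ suc q ] (+ L))) (L<2+q*L q)))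

  -- Walk once around C_L through φ: the signed number of steps is ≡ 0 (mod L), has the parity
  -- of the odd number L and absolute value ≤ L, so it is ± L and every step has the same sign.
  endomorphism-rotates : (φ : ℕ → ℕ) →
    (∀ a b → a < L → b < L → adjCycle a b ≡ true → adjCycle (φ a) (φ b) ≡ true) →
    Σ Bool λ β → ∀ a → a < L → + φ a ≡ + φ 0 Z.+ ⟦ β ⟧ Z.* + a mod L
  endomorphism-rotates φ φ-hom = β , position-rotated
    where
    ψ : ℕ → ℕ
    ψ a = φ (a % L)

    ψ≡φ : ∀ {a} → a < L → ψ a ≡ φ a
    ψ≡φ a<L = cong φ (m<n⇒m%n≡m a<L)

    ψ-closed : ψ L ≡ ψ 0
    ψ-closed = cong φ (n%n≡0 L)

    ψ-walk : ∀ a → a < L → adjCycle (ψ a) (ψ (suc a)) ≡ true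
    ψ-walk a a<L with NP.m<1+n⇒m<n∨m≡n (s≤s a<L)
    ... | inj₁ 1+a<L rewrite ψ≡φ a<L | ψ≡φ 1+a<L = φ-hom a (suc a) a<L 1+a<L (adjCycle-suc a)
    ... | inj₂ refl rewrite ψ≡φ a<L | ψ-closed = φ-hom a 0 a<L (s≤s z≤n) adjCycle-wrap

    σ : ℕ → Bool
    σ a = arc (ψ a) (ψ (suc a))

    position : ∀ k → k ≤ L → + ψ k ≡ + ψ 0 Z.+ signed-sum σ k mod L
    position zero _ = ≡-mod-reflexive (sym (ZP.+-identityʳ _))
    position (suc k) k<L = ≡-mod-trans (adjCycle-step (ψ-walk k k<L))
      (≡-mod-trans (≡-mod-+ʳ ⟦ σ k ⟧ (position k (NP.<⇒≤ k<L))) (≡-mod-reflexive (ZP.+-assoc (+ ψ 0) (signed-sum σ k) ⟦ σ k ⟧)))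

    winding≡0 : signed-sum σ L ≡ 0ℤ mod L
    winding≡0 = ≡-mod-cancelˡ (+ ψ 0) (≡-mod-trans (≡-mod-sym (position L NP.≤-refl))
      (≡-mod-reflexive (trans (cong +_ ψ-closed) (sym (ZP.+-identityʳ _)))))

    turn : Σ Bool λ β → signed-sum σ L ≡ ⟦ β ⟧ Z.* + L
    turn = full-turn (signed-sum σ L) (proj₁ (signed-sum-parity σ L)) winding≡0
             (∣signed-sum∣≤ σ L) (proj₂ (signed-sum-parity σ L))

    β : Bool
    β = proj₁ turn

    position-rotated : ∀ a → a < L → + φ a ≡ + φ 0 Z.+ ⟦ β ⟧ Z.* + a mod L
    position-rotated a a<L = subst₂ (λ x y → + x ≡ + y Z.+ ⟦ β ⟧ Z.* + a mod L) (ψ≡φ a<L) (ψ≡φ {0} (s≤s z≤n)) (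
      ≡-mod-trans (position a (NP.<⇒≤ a<L)) (≡-mod-reflexive (cong (λ s → + ψ 0 Z.+ s)
        (signed-sum-constant σ β a λ b b<a → signed-sum-extremal σ β L (proj₂ turn) b (NP.<-trans b<a a<L)))))

-- The graphs Γ w

even : ℕ → Bool
even zero = true
even (suc n) = not (even n)

even-+3 : ∀ a → even a ≢ even (a + 3)
even-+3 a rewrite NP.+-comm a 3 = not-¬ (sym (BP.not-involutive (even a)))

data Vertex : Set where
  rim twin altHub : ℕ → Vertex
  hub pad : Vertex

index : Vertex → ℕ
index (rim a) = a
index (twin a) = a
index _ = 0

isHub : Vertex → Bool
isHub (altHub _) = true
isHub hub = true
isHub _ = false

offset : Fin 2 → ℕ
offset Fin.zero = 0
offset (Fin.suc Fin.zero) = 4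

bitArc : ∀ {k} → (Fin k → Fin 2) → ℕ → ℕ → ℕ → Bool
bitArc {zero} w p a b = false
bitArc {suc k} w p a b = ((a ≡ᵇ p + offset (w Fin.zero)) ∧ (b ≡ᵇ a + 3)) ∨ bitArc (w ∘ Fin.suc) (p + 8) a b

bitArc-shape : ∀ {k} (w : Fin k → Fin 2) p a b → bitArc w p a b ≡ true → p ≤ a × b ≡ a + 3
bitArc-shape {suc k} w p a b a→b with ∨-true {(a ≡ᵇ p + offset (w Fin.zero)) ∧ (b ≡ᵇ a + 3)} a→b
... | inj₁ here with a≡ , b≡ ← ∧-true {a ≡ᵇ _} here =
  subst (p ≤_) (sym (≡ᵇ-true⇒≡ a≡)) (NP.m≤m+n p _) , ≡ᵇ-true⇒≡ b≡
... | inj₂ later with p+8≤a , b≡ ← bitArc-shape (w ∘ Fin.suc) (p + 8) a b later = NP.≤-trans (NP.m≤m+n p 8) p+8≤a , b≡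

offset≤4 : ∀ γ → offset γ ≤ 4
offset≤4 Fin.zero = z≤n
offset≤4 (Fin.suc Fin.zero) = NP.≤-refl

offset-injective : ∀ {γ δ} → offset γ ≡ offset δ → γ ≡ δ
offset-injective {Fin.zero} {Fin.zero} _ = refl
offset-injective {Fin.suc Fin.zero} {Fin.suc Fin.zero} _ = refl
offset-injective {Fin.zero} {Fin.suc Fin.zero} ()
offset-injective {Fin.suc Fin.zero} {Fin.zero} ()

bitPosition : ℕ → ∀ {k} → Fin k → Fin 2 → ℕ
bitPosition p j γ = p + (toℕ j * 8 + offset γ)

bitArc-at : ∀ {k} (w : Fin k → Fin 2) p j → let a = bitPosition p j (w j) in bitArc w p a (a + 3) ≡ true
bitArc-at w p Fin.zero
  rewrite ≡⇒≡ᵇ-true (refl {x = p + offset (w Fin.zero)}) | ≡⇒≡ᵇ-true (refl {x = p + offset (w Fin.zero) + 3}) = refl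
bitArc-at w p (Fin.suc j) rewrite sym (NP.+-assoc p 8 (toℕ j * 8 + offset (w (Fin.suc j))))
  | bitArc-at (w ∘ Fin.suc) (p + 8) j = BP.∨-zeroʳ _

bitArc-reads : ∀ {k} (w : Fin k → Fin 2) p j γ → let a = bitPosition p j γ in bitArc w p a (a + 3) ≡ true → w j ≡ γ
bitArc-reads w p Fin.zero γ a→ with ∨-true {(p + offset γ ≡ᵇ p + offset (w Fin.zero)) ∧ _} a→
... | inj₁ here = sym (offset-injective (NP.+-cancelˡ-≡ p _ _ (≡ᵇ-true⇒≡ (proj₁ (∧-true {p + offset γ ≡ᵇ _} here)))))
... | inj₂ later = contradiction (proj₁ (bitArc-shape (w ∘ Fin.suc) (p + 8) _ _ later))
  (NP.<⇒≱ (NP.+-monoʳ-< p (NP.≤-trans (s≤s (offset≤4 γ)) (NP.m≤m+n 5 3))))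
bitArc-reads w p (Fin.suc j) γ a→ with ∨-true {(bitPosition p (Fin.suc j) γ ≡ᵇ p + offset (w Fin.zero)) ∧ _} a→
... | inj₁ here = contradiction (NP.+-cancelˡ-≡ p _ _ (≡ᵇ-true⇒≡ (proj₁ (∧-true {bitPosition p (Fin.suc j) γ ≡ᵇ _} here))))
  λ eq → NP.<⇒≱ (NP.≤-trans (s≤s (offset≤4 (w Fin.zero))) (NP.m≤m+n 5 3)) (subst (8 ≤_) eq (NP.m≤m+n 8 _))
... | inj₂ later rewrite sym (NP.+-assoc p 8 (toℕ j * 8 + offset γ)) = bitArc-reads (w ∘ Fin.suc) (p + 8) j γ later

data LabelShape (a b : ℕ) : Set where
  marker₆ : a ≡ 1 → b ≡ 6 → LabelShape a b
  marker₈ : a ≡ 1 → b ≡ 8 → LabelShape a b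
  bit : 11 ≤ a → b ≡ a + 3 → LabelShape a b

label-parity : ∀ {a b} → LabelShape a b → even a ≢ even b
label-parity (marker₆ refl refl) = λ ()
label-parity (marker₈ refl refl) = λ ()
label-parity {a} (bit _ refl) = even-+3 a

no-label-back-by-3 : ∀ {a} → LabelShape (a + 3) a → ⊥
no-label-back-by-3 {a} (marker₆ a+3≡1 _) = NP.<⇒≱ (s≤s (s≤s z≤n)) (subst (3 ≤_) a+3≡1 (NP.m≤n+m 3 a))
no-label-back-by-3 {a} (marker₈ a+3≡1 _) = NP.<⇒≱ (s≤s (s≤s z≤n)) (subst (3 ≤_) a+3≡1 (NP.m≤n+m 3 a))
no-label-back-by-3 {a} (bit _ a≡a+3+3) = NP.<⇒≢ (NP.<-≤-trans (NP.m<m+n a (s≤s z≤n)) (NP.m≤m+n (a + 3) 3)) a≡a+3+3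

data LabelGap : ℕ → Set where
  gap₃ : LabelGap 3
  gap₅ : LabelGap 5
  gap₇ : LabelGap 7

label-gap : ∀ {a b} → LabelShape a b → Σ ℕ λ g → LabelGap g × b ≡ a + g
label-gap (marker₆ refl refl) = 5 , gap₅ , refl
label-gap (marker₈ refl refl) = 7 , gap₇ , refl
label-gap (bit _ b≡a+3) = 3 , gap₃ , b≡a+3

data IsBase : Vertex → Set where
  rim : ∀ a → IsBase (rim a)
  twin : ∀ a → IsBase (twin a)

module Construction (m : ℕ) where
  open OddCycle (5 + 4 * m) public

  Word : Set
  Word = Fin m → Fin 2

  13≤L : 13 ≤ L
  13≤L = NP.≤-trans (NP.m≤m+n 13 (8 * m)) (NP.≤-reflexive (L≡ m))
    where
    L≡ : ∀ m → 13 + 8 * m ≡ suc (suc (5 + 4 * m) + suc (5 + 4 * m))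
    L≡ = NatSolver.solve-∀

  small-distinct⇒≢-mod : ∀ {x y} → x ≡ y mod L → T (∣ x Z.- y ∣ <ᵇ 13) → x ≢ y → ⊥
  small-distinct⇒≢-mod x≡y small x≢y =
    x≢y (≡-mod⇒≡ x≡y (NP.<-≤-trans (NP.<ᵇ⇒< _ 13 small) 13≤L))

  no-signed-triangle : ∀ d₁ d₂ d₃ → ⟦ d₁ ⟧ Z.+ ⟦ d₂ ⟧ ≡ ⟦ d₃ ⟧ mod L → ⊥
  no-signed-triangle true true true h = small-distinct⇒≢-mod h _ λ ()
  no-signed-triangle true true false h = small-distinct⇒≢-mod h _ λ ()
  no-signed-triangle true false true h = small-distinct⇒≢-mod h _ λ ()
  no-signed-triangle true false false h = small-distinct⇒≢-mod h _ λ ()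
  no-signed-triangle false true true h = small-distinct⇒≢-mod h _ λ ()
  no-signed-triangle false true false h = small-distinct⇒≢-mod h _ λ ()
  no-signed-triangle false false true h = small-distinct⇒≢-mod h _ λ ()
  no-signed-triangle false false false h = small-distinct⇒≢-mod h _ λ ()

  C-triangle-free : ∀ a b c → adjCycle a b ≡ true → adjCycle b c ≡ true → adjCycle a c ≡ true → ⊥
  C-triangle-free a b c ab bc ac = no-signed-triangle (arc a b) (arc b c) (arc a c) (≡-mod-cancelˡ (+ a)
    (≡-mod-trans (≡-mod-reflexive (sym (ZP.+-assoc (+ a) ⟦ arc a b ⟧ ⟦ arc b c ⟧)))
    (≡-mod-trans (≡-mod-sym (≡-mod-trans (adjCycle-step {b} {c} bc) (≡-mod-+ʳ ⟦ arc b c ⟧ (adjCycle-step {a} {b} ab))))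
      (adjCycle-step {a} {c} ac))))

  no-cycle-label-triangle : ∀ d₁ d₂ {g} → LabelGap g → ⟦ d₁ ⟧ Z.+ + g ≡ ⟦ d₂ ⟧ mod L → ⊥
  no-cycle-label-triangle true true gap₃ h = small-distinct⇒≢-mod h _ λ ()
  no-cycle-label-triangle true false gap₃ h = small-distinct⇒≢-mod h _ λ ()
  no-cycle-label-triangle false true gap₃ h = small-distinct⇒≢-mod h _ λ ()
  no-cycle-label-triangle false false gap₃ h = small-distinct⇒≢-mod h _ λ ()
  no-cycle-label-triangle true true gap₅ h = small-distinct⇒≢-mod h _ λ ()
  no-cycle-label-triangle true false gap₅ h = small-distinct⇒≢-mod h _ λ ()
  no-cycle-label-triangle false true gap₅ h = small-distinct⇒≢-mod h _ λ ()
  no-cycle-label-triangle false false gap₅ h = small-distinct⇒≢-mod h _ λ ()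
  no-cycle-label-triangle true true gap₇ h = small-distinct⇒≢-mod h _ λ ()
  no-cycle-label-triangle true false gap₇ h = small-distinct⇒≢-mod h _ λ ()
  no-cycle-label-triangle false true gap₇ h = small-distinct⇒≢-mod h _ λ ()
  no-cycle-label-triangle false false gap₇ h = small-distinct⇒≢-mod h _ λ ()

  C-label-triangle-free : ∀ a b c → adjCycle a b ≡ true → adjCycle a c ≡ true → LabelShape b c → ⊥
  C-label-triangle-free a b c ab ac shape with label-gap shape
  ... | g , gap , refl = no-cycle-label-triangle (arc a b) (arc a c) gap (≡-mod-cancelˡ (+ a)
    (≡-mod-trans (≡-mod-reflexive (sym (ZP.+-assoc (+ a) ⟦ arc a b ⟧ (+ g))))
    (≡-mod-trans (≡-mod-+ʳ (+ g) (≡-mod-sym (adjCycle-step {a} {b} ab)))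
    (≡-mod-trans (≡-mod-reflexive (sym (ZP.pos-+ b g))) (adjCycle-step {a} {c} ac)))))

  data BaseEdge (a b : ℕ) : Set where
    cycle : ∀ d → + b ≡ + a Z.+ ⟦ d ⟧ mod L → BaseEdge a b
    label : LabelShape a b → BaseEdge a b
    label⁻¹ : LabelShape b a → BaseEdge a b

  no-one-sided-midpoint : ∀ β d → ⟦ d ⟧ Z.- ⟦ β ⟧ ≡ ⟦ β ⟧ Z.- ⟦ not β ⟧ mod L → ⊥
  no-one-sided-midpoint true true h = small-distinct⇒≢-mod h _ λ ()
  no-one-sided-midpoint true false h = small-distinct⇒≢-mod h _ λ ()
  no-one-sided-midpoint false true h = small-distinct⇒≢-mod h _ λ ()
  no-one-sided-midpoint false false h = small-distinct⇒≢-mod h _ λ ()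

  midpoint : ∀ β d₁ d₂ {P X} → P Z.+ ⟦ d₁ ⟧ ≡ X Z.+ ⟦ not β ⟧ mod L → P Z.+ ⟦ d₂ ⟧ ≡ X Z.+ ⟦ β ⟧ mod L →
    P ≡ X mod L
  midpoint β d₁ d₂ {P} {X} h₁ h₂ with d₁ BP.≟ β
  ... | no d₁≢β rewrite ¬-not d₁≢β = ≡-mod-cancelʳ ⟦ not β ⟧ h₁
  ... | yes refl = ⊥-elim (no-one-sided-midpoint β d₂
    (≡-mod-trans (≡-mod-reflexive (lemma P ⟦ d₂ ⟧ ⟦ β ⟧)) (≡-mod-difference X ⟦ not β ⟧ ⟦ β ⟧ h₁ h₂)))
    where
    lemma : ∀ p d b → d Z.- b ≡ (p Z.+ d) Z.- (p Z.+ b)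
    lemma = solve-∀

  +[a+3]-a : ∀ a → + (a + 3) Z.- + a ≡ + 3
  +[a+3]-a a = trans (cong (λ x → x Z.- + a) (ZP.pos-+ a 3)) (lemma (+ a))
    where
    lemma : ∀ a → (a Z.+ + 3) Z.- a ≡ + 3
    lemma = solve-∀

  +a-[a+3] : ∀ a → + a Z.- + (a + 3) ≡ Z.- + 3
  +a-[a+3] a = trans (cong (λ x → + a Z.- x) (ZP.pos-+ a 3)) (lemma (+ a))
    where
    lemma : ∀ a → a Z.- (a Z.+ + 3) ≡ Z.- + 3
    lemma = solve-∀

  no-edge-from-6-backwards-7 : ∀ {P} → BaseEdge 6 P → + P Z.- + 6 ≡ Z.- + 7 mod L → ⊥
  no-edge-from-6-backwards-7 (cycle true k) D = small-distinct⇒≢-mod (≡-mod-trans (≡-mod-sym (≡-mod-shift (+ 6) 1ℤ k)) D) _ λ ()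
  no-edge-from-6-backwards-7 (cycle false k) D = small-distinct⇒≢-mod (≡-mod-trans (≡-mod-sym (≡-mod-shift (+ 6) -1ℤ k)) D) _ λ ()
  no-edge-from-6-backwards-7 (label (bit (s≤s (s≤s (s≤s (s≤s (s≤s (s≤s ())))))) _)) _
  no-edge-from-6-backwards-7 (label⁻¹ (marker₆ refl refl)) D = small-distinct⇒≢-mod D _ λ ()
  no-edge-from-6-backwards-7 (label⁻¹ (bit 11≤P 6≡P+3)) _ =
    NP.<⇒≱ (s≤s (s≤s (s≤s (s≤s (s≤s (s≤s (s≤s z≤n))))))) (subst (14 ≤_) (sym 6≡P+3) (NP.+-monoˡ-≤ 3 11≤P))

  -- The asymmetric markers {1,6} and {1,8} rule out every rotation and reflection but the identity.
  markers-fix-frame : ∀ β c {P₁ P₆ P₈} →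
    + P₁ ≡ c Z.+ ⟦ β ⟧ Z.* + 1 mod L → + P₆ ≡ c Z.+ ⟦ β ⟧ Z.* + 6 mod L → + P₈ ≡ c Z.+ ⟦ β ⟧ Z.* + 8 mod L →
    BaseEdge P₁ P₆ → BaseEdge P₁ P₈ → β ≡ true × (c ≡ 0ℤ mod L)
  markers-fix-frame true c {P₁} {P₆} h₁ h₆ h₈ e₁₆ e₁₈ = refl , frame e₁₆
    where
    D : + P₆ Z.- + P₁ ≡ + 5 mod L
    D = ≡-mod-difference c (⟦ true ⟧ Z.* + 1) (⟦ true ⟧ Z.* + 6) h₁ h₆
    frame : BaseEdge _ _ → c ≡ 0ℤ mod L
    frame (cycle true k) = ⊥-elim (small-distinct⇒≢-mod (≡-mod-trans (≡-mod-sym (≡-mod-shift (+ P₁) 1ℤ k)) D) _ λ ())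
    frame (cycle false k) = ⊥-elim (small-distinct⇒≢-mod (≡-mod-trans (≡-mod-sym (≡-mod-shift (+ P₁) -1ℤ k)) D) _ λ ())
    frame (label (marker₆ refl refl)) = ≡-mod-sym (≡-mod-cancelʳ 1ℤ h₁)
    frame (label (marker₈ refl refl)) = ⊥-elim (small-distinct⇒≢-mod D _ λ ())
    frame (label (bit _ refl)) = ⊥-elim (small-distinct⇒≢-mod (≡-mod-trans (≡-mod-reflexive (sym (+[a+3]-a P₁))) D) _ λ ())
    frame (label⁻¹ (marker₆ refl refl)) = ⊥-elim (small-distinct⇒≢-mod D _ λ ())
    frame (label⁻¹ (marker₈ refl refl)) = ⊥-elim (small-distinct⇒≢-mod D _ λ ())
    frame (label⁻¹ (bit _ refl)) = ⊥-elim (small-distinct⇒≢-mod (≡-mod-trans (≡-mod-reflexive (sym (+a-[a+3] P₆))) D) _ λ ())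
  markers-fix-frame false c {P₁} {P₆} h₁ h₆ h₈ e₁₆ e₁₈ = ⊥-elim (reflected e₁₆ e₁₈)
    where
    D : + P₆ Z.- + P₁ ≡ Z.- + 5 mod L
    D = ≡-mod-difference c (⟦ false ⟧ Z.* + 1) (⟦ false ⟧ Z.* + 6) h₁ h₆
    reflected : BaseEdge _ _ → BaseEdge _ _ → ⊥
    reflected (cycle true k) _ = small-distinct⇒≢-mod (≡-mod-trans (≡-mod-sym (≡-mod-shift (+ P₁) 1ℤ k)) D) _ λ ()
    reflected (cycle false k) _ = small-distinct⇒≢-mod (≡-mod-trans (≡-mod-sym (≡-mod-shift (+ P₁) -1ℤ k)) D) _ λ ()
    reflected (label (marker₆ refl refl)) _ = small-distinct⇒≢-mod D _ λ ()
    reflected (label (marker₈ refl refl)) _ = small-distinct⇒≢-mod D _ λ ()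
    reflected (label (bit _ refl)) _ = small-distinct⇒≢-mod (≡-mod-trans (≡-mod-reflexive (sym (+[a+3]-a P₁))) D) _ λ ()
    reflected (label⁻¹ (marker₆ refl refl)) e₁₈ = no-edge-from-6-backwards-7 e₁₈ (≡-mod-difference c (⟦ false ⟧ Z.* + 1) (⟦ false ⟧ Z.* + 8) h₁ h₈)
    reflected (label⁻¹ (marker₈ refl refl)) _ = small-distinct⇒≢-mod D _ λ ()
    reflected (label⁻¹ (bit _ refl)) _ = small-distinct⇒≢-mod (≡-mod-trans (≡-mod-reflexive (sym (+a-[a+3] P₆))) D) _ λ ()

  module Γ (w : Word) where

    labelArc : ℕ → ℕ → Bool
    labelArc a b = ((a ≡ᵇ 1) ∧ ((b ≡ᵇ 6) ∨ (b ≡ᵇ 8))) ∨ bitArc w 11 a b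

    labelEdge : ℕ → ℕ → Bool
    labelEdge a b = labelArc a b ∨ labelArc b a

    adjacent : Vertex → Vertex → Bool
    adjacent (rim a) (rim b) = adjCycle a b
    adjacent (rim a) (twin b) = adjCycle a b
    adjacent (rim a) (altHub k) = not (a ≡ᵇ k)
    adjacent (rim a) hub = true
    adjacent (twin a) (rim b) = adjCycle a b
    adjacent (twin a) (twin b) = labelEdge a b
    adjacent (twin a) (altHub k) = a ≡ᵇ k
    adjacent (altHub k) (rim a) = not (a ≡ᵇ k)
    adjacent (altHub k) (twin a) = a ≡ᵇ k
    adjacent hub (rim a) = true
    adjacent _ _ = false

    adjacent-sym : ∀ u v → adjacent u v ≡ adjacent v u
    adjacent-sym (rim a) (rim b) = adjCycle-sym a b
    adjacent-sym (rim a) (twin b) = adjCycle-sym a b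
    adjacent-sym (twin a) (rim b) = adjCycle-sym a b
    adjacent-sym (twin a) (twin b) = BP.∨-comm (labelArc a b) (labelArc b a)
    adjacent-sym (rim _) (altHub _) = refl
    adjacent-sym (rim _) hub = refl
    adjacent-sym (rim _) pad = refl
    adjacent-sym (twin _) (altHub _) = refl
    adjacent-sym (twin _) hub = refl
    adjacent-sym (twin _) pad = refl
    adjacent-sym (altHub _) (rim _) = refl
    adjacent-sym (altHub _) (twin _) = refl
    adjacent-sym (altHub _) (altHub _) = refl
    adjacent-sym (altHub _) hub = refl
    adjacent-sym (altHub _) pad = refl
    adjacent-sym hub (rim _) = refl
    adjacent-sym hub (twin _) = refl
    adjacent-sym hub (altHub _) = refl
    adjacent-sym hub hub = refl
    adjacent-sym hub pad = refl
    adjacent-sym pad (rim _) = refl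
    adjacent-sym pad (twin _) = refl
    adjacent-sym pad (altHub _) = refl
    adjacent-sym pad hub = refl
    adjacent-sym pad pad = refl

    labelArc-shape : ∀ {a b} → labelArc a b ≡ true → LabelShape a b
    labelArc-shape {a} {b} a→b with ∨-true {(a ≡ᵇ 1) ∧ ((b ≡ᵇ 6) ∨ (b ≡ᵇ 8))} a→b
    ... | inj₂ bit-arc = bit (proj₁ (bitArc-shape w 11 a b bit-arc)) (proj₂ (bitArc-shape w 11 a b bit-arc))
    ... | inj₁ marker with a≡1 , b≡6∨8 ← ∧-true {a ≡ᵇ 1} marker with ∨-true {b ≡ᵇ 6} b≡6∨8
    ...   | inj₁ b≡6 = marker₆ (≡ᵇ-true⇒≡ a≡1) (≡ᵇ-true⇒≡ b≡6)
    ...   | inj₂ b≡8 = marker₈ (≡ᵇ-true⇒≡ a≡1) (≡ᵇ-true⇒≡ b≡8)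

    labelEdge-parity : ∀ {a b} → labelEdge a b ≡ true → even a ≢ even b
    labelEdge-parity {a} {b} ab with ∨-true {labelArc a b} ab
    ... | inj₁ a→b = label-parity (labelArc-shape a→b)
    ... | inj₂ b→a = λ e → label-parity (labelArc-shape b→a) (sym e)

    labelEdge-irrefl : ∀ a → labelEdge a a ≡ false
    labelEdge-irrefl a with labelEdge a a in aa
    ... | false = refl
    ... | true = contradiction refl (labelEdge-parity {a} {a} aa)

    adjacent-irrefl : ∀ v → adjacent v v ≡ false
    adjacent-irrefl (rim a) = adjCycle-irrefl a
    adjacent-irrefl (twin a) = labelEdge-irrefl a
    adjacent-irrefl (altHub _) = refl
    adjacent-irrefl hub = refl
    adjacent-irrefl pad = refl

    C-labelEdge-triangle-free : ∀ a b c → adjCycle a b ≡ true → adjCycle a c ≡ true → labelEdge b c ≡ true → ⊥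
    C-labelEdge-triangle-free a b c ab ac bc with ∨-true {labelArc b c} bc
    ... | inj₁ b→c = C-label-triangle-free a b c ab ac (labelArc-shape b→c)
    ... | inj₂ c→b = C-label-triangle-free a c b ac ab (labelArc-shape c→b)

    base-triangle-free : ∀ {u v x} → IsBase u → IsBase v → IsBase x →
      adjacent u v ≡ true → adjacent v x ≡ true → adjacent u x ≡ true → ⊥
    base-triangle-free (rim a) (rim b) (rim c) ab bc ac = C-triangle-free a b c ab bc ac
    base-triangle-free (rim a) (rim b) (twin c) ab bc ac = C-triangle-free a b c ab bc ac
    base-triangle-free (rim a) (twin b) (rim c) ab bc ac = C-triangle-free a b c ab bc ac
    base-triangle-free (twin a) (rim b) (rim c) ab bc ac = C-triangle-free a b c ab bc ac
    base-triangle-free (rim a) (twin b) (twin c) ab bc ac = C-labelEdge-triangle-free a b c ab ac bc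
    base-triangle-free (twin a) (rim b) (twin c) ab bc ac =
      C-labelEdge-triangle-free b a c (trans (adjCycle-sym b a) ab) bc ac
    base-triangle-free (twin a) (twin b) (rim c) ab bc ac =
      C-labelEdge-triangle-free c a b (trans (adjCycle-sym c a) ac) (trans (adjCycle-sym c b) bc) ab
    base-triangle-free (twin a) (twin b) (twin c) ab bc ac =
      labelEdge-parity {a} {c} ac (≢-≢⇒≡ (labelEdge-parity {a} {b} ab) (labelEdge-parity {b} {c} bc))

    hubs-independent : ∀ u x → isHub u ≡ true → isHub x ≡ true → adjacent u x ≡ false
    hubs-independent (altHub _) (altHub _) _ _ = refl
    hubs-independent (altHub _) hub _ _ = refl
    hubs-independent hub (altHub _) _ _ = refl
    hubs-independent hub hub _ _ = refl

    adjacent-pad : ∀ v → adjacent v pad ≡ false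
    adjacent-pad (rim _) = refl
    adjacent-pad (twin _) = refl
    adjacent-pad (altHub _) = refl
    adjacent-pad hub = refl
    adjacent-pad pad = refl

    non-hub-is-base : ∀ v u → isHub u ≡ false → adjacent v u ≡ true → IsBase u
    non-hub-is-base v (rim a) _ _ = rim a
    non-hub-is-base v (twin a) _ _ = twin a
    non-hub-is-base v pad _ vu with () ← trans (sym vu) (adjacent-pad v)

    non-hub-neighbourhood : ∀ v u x → isHub v ≡ false → adjacent v u ≡ true → adjacent v x ≡ true → adjacent u x ≡ true →
      isHub u ≢ isHub x
    non-hub-neighbourhood v u x v-non-hub vu vx ux with isHub u in u-hub | isHub x in x-hub
    ... | true | true = λ _ → case trans (sym ux) (hubs-independent u x u-hub x-hub) of λ ()
    ... | true | false = λ ()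
    ... | false | true = λ ()
    ... | false | false = λ _ → base-triangle-free (non-hub-is-base u v v-non-hub (trans (adjacent-sym u v) vu))
      (non-hub-is-base v u u-hub vu) (non-hub-is-base v x x-hub vx) vu ux vx

    hub-neighbour-is-base : ∀ H u → isHub H ≡ true → adjacent H u ≡ true → IsBase u
    hub-neighbour-is-base (altHub _) (rim a) _ _ = rim a
    hub-neighbour-is-base (altHub _) (twin a) _ _ = twin a
    hub-neighbour-is-base hub (rim a) _ _ = rim a

    hub-neighbourhood-on-cycle : ∀ H u x → isHub H ≡ true → adjacent H u ≡ true → adjacent H x ≡ true → adjacent u x ≡ true →
      adjCycle (index u) (index x) ≡ true
    hub-neighbourhood-on-cycle hub (rim _) (rim _) _ _ _ ux = ux
    hub-neighbourhood-on-cycle (altHub _) (rim _) (rim _) _ _ _ ux = ux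
    hub-neighbourhood-on-cycle (altHub _) (rim _) (twin _) _ _ _ ux = ux
    hub-neighbourhood-on-cycle (altHub _) (twin _) (rim _) _ _ _ ux = ux
    hub-neighbourhood-on-cycle (altHub k) (twin a) (twin b) _ Hu Hx ux
      rewrite ≡ᵇ-true⇒≡ {a} Hu | ≡ᵇ-true⇒≡ {b} Hx | labelEdge-irrefl k with () ← ux

    base-adjacent : ∀ {u x} → IsBase u → IsBase x → adjacent u x ≡ true →
      adjCycle (index u) (index x) ≡ true ⊎ labelEdge (index u) (index x) ≡ true
    base-adjacent (rim a) (rim b) ab = inj₁ ab
    base-adjacent (rim a) (twin b) ab = inj₁ ab
    base-adjacent (twin a) (rim b) ab = inj₁ ab
    base-adjacent (twin a) (twin b) ab = inj₂ ab

    base-edge : ∀ {u x} → IsBase u → IsBase x → adjacent u x ≡ true → BaseEdge (index u) (index x)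
    base-edge {u} {x} u-base x-base ux with base-adjacent u-base x-base ux
    ... | inj₁ cyc = cycle (arc (index u) (index x)) (adjCycle-step {index u} {index x} cyc)
    ... | inj₂ lab with ∨-true {labelArc (index u) (index x)} lab
    ...   | inj₁ u→x = label (labelArc-shape u→x)
    ...   | inj₂ x→u = label⁻¹ (labelArc-shape x→u)

    labelArc-bit : ∀ {a b} → 11 ≤ a → labelArc a b ≡ true → bitArc w 11 a b ≡ true
    labelArc-bit {a} {b} 11≤a a→b with ∨-true {(a ≡ᵇ 1) ∧ ((b ≡ᵇ 6) ∨ (b ≡ᵇ 8))} a→b
    ... | inj₂ bit-arc = bit-arc
    ... | inj₁ marker with refl ← ≡ᵇ-true⇒≡ {a} {1} (proj₁ (∧-true {a ≡ᵇ 1} marker)) with s≤s () ← 11≤a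

  -- Homomorphisms between the graphs Γ w

  Valid : Vertex → Set
  Valid (rim a) = a < L
  Valid (twin a) = a < L
  Valid (altHub a) = a < L
  Valid hub = ⊤
  Valid pad = ⊤

  no-cycle-step-3 : ∀ a → adjCycle a (a + 3) ≡ true → ⊥
  no-cycle-step-3 a cyc = three≢sign (arc a (a + 3))
    (≡-mod-trans (≡-mod-reflexive (sym (+[a+3]-a a))) (≡-mod-shift (+ a) _ (adjCycle-step {a} {a + 3} cyc)))
    where
    three≢sign : ∀ d → + 3 ≡ ⟦ d ⟧ mod L → ⊥
    three≢sign true h = small-distinct⇒≢-mod h _ λ ()
    three≢sign false h = small-distinct⇒≢-mod h _ λ ()

  small<L : ∀ n → T (n <ᵇ 13) → n < L
  small<L n small = NP.<-≤-trans (NP.<ᵇ⇒< n 13 small) 13≤L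

  bitPosition+5≤L : ∀ (j : Fin m) γ → bitPosition 11 j γ + 5 ≤ L
  bitPosition+5≤L j γ = begin
    11 + (toℕ j * 8 + offset γ) + 5 ≤⟨ NP.+-monoˡ-≤ 5 (NP.+-monoʳ-≤ 11 (NP.+-monoʳ-≤ (toℕ j * 8) (offset≤4 γ))) ⟩
    11 + (toℕ j * 8 + 4) + 5        ≡⟨ lemma (toℕ j) ⟩
    12 + suc (toℕ j) * 8            ≤⟨ NP.+-monoʳ-≤ 12 (NP.*-monoˡ-≤ 8 (FP.toℕ<n j)) ⟩
    12 + m * 8                      ≤⟨ NP.n≤1+n _ ⟩
    13 + m * 8                      ≡⟨ L≡ m ⟩
    L                               ∎
    where
    open NP.≤-Reasoning
    lemma : ∀ t → 11 + (t * 8 + 4) + 5 ≡ 12 + suc t * 8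
    lemma = NatSolver.solve-∀
    L≡ : ∀ m → 13 + m * 8 ≡ suc (suc (5 + 4 * m) + suc (5 + 4 * m))
    L≡ = NatSolver.solve-∀

  valid-base-index : ∀ {u} → IsBase u → Valid u → index u < L
  valid-base-index (rim _) a<L = a<L
  valid-base-index (twin _) a<L = a<L

  module Rigidity (wS wT : Word) (F : Vertex → Vertex)
    (F-hom : ∀ u v → Valid u → Valid v → Γ.adjacent wS u v ≡ true → Γ.adjacent wT (F u) (F v) ≡ true)
    (F-valid : ∀ v → Valid (F v)) where

    module S = Γ wS
    module T = Γ wT

    -- The image of a wheel centre is a hub: otherwise isHub would 2-colour the image of the rim.
    wheel-centre↦hub : ∀ H (z : ℕ → Vertex) → Valid H → (∀ a → a < L → Valid (z a)) →
      (∀ a → a < L → S.adjacent H (z a) ≡ true) →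
      (∀ a b → a < L → b < L → adjCycle a b ≡ true → S.adjacent (z a) (z b) ≡ true) →
      isHub (F H) ≡ true
    wheel-centre↦hub H z H-valid z-valid Hz zz with isHub (F H) in FH-hub
    ... | true = refl
    ... | false = ⊥-elim (odd-cycle-not-bipartite (isHub ∘ F ∘ z) λ a b a<L b<L ab →
      T.non-hub-neighbourhood (F H) (F (z a)) (F (z b)) FH-hub
        (F-hom H (z a) H-valid (z-valid a a<L) (Hz a a<L)) (F-hom H (z b) H-valid (z-valid b b<L) (Hz b b<L))
        (F-hom (z a) (z b) (z-valid a a<L) (z-valid b b<L) (zz a b a<L b<L ab)))

    hub↦hub : isHub (F hub) ≡ true
    hub↦hub = wheel-centre↦hub hub rim tt (λ _ a<L → a<L) (λ _ _ → refl) (λ _ _ _ _ ab → ab)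

    altHub↦hub : ∀ k → k < L → isHub (F (altHub k)) ≡ true
    altHub↦hub k k<L = wheel-centre↦hub (altHub k) z k<L z-valid altHub-z z-z
      where
      z : ℕ → Vertex
      z a = if a ≡ᵇ k then twin k else rim a

      z-valid : ∀ a → a < L → Valid (z a)
      z-valid a a<L with a ≡ᵇ k
      ... | true = k<L
      ... | false = a<L

      altHub-z : ∀ a → a < L → S.adjacent (altHub k) (z a) ≡ true
      altHub-z a _ with a ≡ᵇ k in a≡k
      ... | true = ≡⇒≡ᵇ-true (refl {x = k})
      ... | false rewrite a≡k = refl

      z-z : ∀ a b → a < L → b < L → adjCycle a b ≡ true → S.adjacent (z a) (z b) ≡ true
      z-z a b _ _ ab with a ≡ᵇ k in a≡k | b ≡ᵇ k in b≡k
      ... | true | true with refl ← ≡ᵇ-true⇒≡ {a} a≡k | refl ← ≡ᵇ-true⇒≡ {b} b≡k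
        with () ← trans (sym ab) (adjCycle-irrefl k)
      ... | true | false with refl ← ≡ᵇ-true⇒≡ {a} a≡k = ab
      ... | false | true with refl ← ≡ᵇ-true⇒≡ {b} b≡k = ab
      ... | false | false = ab

    φ : ℕ → ℕ
    φ a = index (F (rim a))

    rotation : Σ Bool λ β → ∀ a → a < L → + φ a ≡ + φ 0 Z.+ ⟦ β ⟧ Z.* + a mod L
    rotation = endomorphism-rotates φ λ a b a<L b<L ab →
      T.hub-neighbourhood-on-cycle (F hub) (F (rim a)) (F (rim b)) hub↦hub
        (F-hom hub (rim a) tt a<L refl) (F-hom hub (rim b) tt b<L refl) (F-hom (rim a) (rim b) a<L b<L ab)

    β : Bool
    β = proj₁ rotation

    c : ℤ
    c = + φ 0

    twin↦base : ∀ k → k < L → IsBase (F (twin k))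
    twin↦base k k<L = T.hub-neighbour-is-base (F (altHub k)) (F (twin k)) (altHub↦hub k k<L)
      (F-hom (altHub k) (twin k) k<L k<L (≡⇒≡ᵇ-true (refl {x = k})))

    twin-position : ∀ k → suc (suc k) < L → + index (F (twin (suc k))) ≡ c Z.+ ⟦ β ⟧ Z.* + suc k mod L
    twin-position k 2+k<L = midpoint β (arc P (φ k)) (arc P (φ (2 + k)))
      (≡-mod-trans (≡-mod-sym (adjCycle-step {P} {φ k} (image-on-cycle k k<L k≢1+k 1+k~k)))
        (≡-mod-trans (proj₂ rotation k k<L) (≡-mod-reflexive left)))
      (≡-mod-trans (≡-mod-sym (adjCycle-step {P} {φ (2 + k)} (image-on-cycle (2 + k) 2+k<L 2+k≢1+k (adjCycle-suc (suc k)))))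
        (≡-mod-trans (proj₂ rotation (2 + k) 2+k<L) (≡-mod-reflexive right)))
      where
      1+k<L : suc k < L
      1+k<L = NP.<-trans (NP.n<1+n (suc k)) 2+k<L
      k<L : k < L
      k<L = NP.<-trans (NP.n<1+n k) 1+k<L
      k≢1+k : k ≢ suc k
      k≢1+k = NP.<⇒≢ (NP.n<1+n k)
      2+k≢1+k : suc (suc k) ≢ suc k
      2+k≢1+k = NP.1+n≢n
      1+k~k : adjCycle (suc k) k ≡ true
      1+k~k = trans (adjCycle-sym (suc k) k) (adjCycle-suc k)
      P : ℕ
      P = index (F (twin (suc k)))
      image-on-cycle : ∀ a → a < L → a ≢ suc k → adjCycle (suc k) a ≡ true → adjCycle P (φ a) ≡ true
      image-on-cycle a a<L a≢1+k twin-rim = T.hub-neighbourhood-on-cycle (F (altHub (suc k))) (F (twin (suc k))) (F (rim a))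
        (altHub↦hub (suc k) 1+k<L) (F-hom (altHub (suc k)) (twin (suc k)) 1+k<L 1+k<L (≡⇒≡ᵇ-true (refl {x = suc k})))
        (F-hom (altHub (suc k)) (rim a) 1+k<L a<L (cong not (≢⇒≡ᵇ-false a≢1+k)))
        (F-hom (twin (suc k)) (rim a) 1+k<L a<L twin-rim)
      left : c Z.+ ⟦ β ⟧ Z.* + k ≡ (c Z.+ ⟦ β ⟧ Z.* + suc k) Z.+ ⟦ not β ⟧
      left = trans (lemma c ⟦ β ⟧ (+ k)) (cong₂ (λ x y → (c Z.+ ⟦ β ⟧ Z.* x) Z.+ y) (sym (ZP.pos-+ 1 k)) (sym (⟦not⟧ β)))
        where
        lemma : ∀ c e k → c Z.+ e Z.* k ≡ (c Z.+ e Z.* (1ℤ Z.+ k)) Z.+ Z.- e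
        lemma = solve-∀
      right : c Z.+ ⟦ β ⟧ Z.* + suc (suc k) ≡ (c Z.+ ⟦ β ⟧ Z.* + suc k) Z.+ ⟦ β ⟧
      right = trans (cong (λ x → c Z.+ ⟦ β ⟧ Z.* x) (ZP.pos-+ 2 k))
        (trans (lemma c ⟦ β ⟧ (+ k)) (cong (λ x → (c Z.+ ⟦ β ⟧ Z.* x) Z.+ ⟦ β ⟧) (sym (ZP.pos-+ 1 k))))
        where
        lemma : ∀ c e k → c Z.+ e Z.* (+ 2 Z.+ k) ≡ (c Z.+ e Z.* (1ℤ Z.+ k)) Z.+ e
        lemma = solve-∀

    twin-edge : ∀ a b → a < L → b < L → S.adjacent (twin a) (twin b) ≡ true →
      BaseEdge (index (F (twin a))) (index (F (twin b)))
    twin-edge a b a<L b<L ab = T.base-edge (twin↦base a a<L) (twin↦base b b<L) (F-hom (twin a) (twin b) a<L b<L ab)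

    frame : β ≡ true × (c ≡ 0ℤ mod L)
    frame = markers-fix-frame β c (twin-position 0 (small<L 2 _)) (twin-position 5 (small<L 7 _))
      (twin-position 7 (small<L 9 _)) (twin-edge 1 6 (small<L 1 _) (small<L 6 _) refl)
      (twin-edge 1 8 (small<L 1 _) (small<L 8 _) refl)

    twin-index : ∀ k → suc (suc k) < L → index (F (twin (suc k))) ≡ suc k
    twin-index k 2+k<L = +≡+-mod⇒≡ (valid-base-index (twin↦base (suc k) 1+k<L) (F-valid (twin (suc k)))) 1+k<L
      (≡-mod-trans (subst (λ b → _ ≡ c Z.+ ⟦ b ⟧ Z.* + suc k mod L) (proj₁ frame) (twin-position k 2+k<L))
        (≡-mod-trans (≡-mod-+ʳ (1ℤ Z.* + suc k) (proj₂ frame)) (≡-mod-reflexive (lemma (+ suc k)))))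
      where
      1+k<L : suc k < L
      1+k<L = NP.<-trans (NP.n<1+n (suc k)) 2+k<L
      lemma : ∀ x → 0ℤ Z.+ 1ℤ Z.* x ≡ x
      lemma = solve-∀

    words-agree : ∀ j → wS j ≡ wT j
    words-agree j = sym (read (subst₂ (λ p q → adjCycle p q ≡ true ⊎ T.labelEdge p q ≡ true) Fa≡a Fa+3≡a+3
      (T.base-adjacent (twin↦base a a<L) (twin↦base (a + 3) a+3<L) (F-hom (twin a) (twin (a + 3)) a<L a+3<L S-bit-edge))))
      where
      x a : ℕ
      x = toℕ j * 8 + offset (wS j)
      a = 11 + x
      a+5≤L : a + 5 ≤ L
      a+5≤L = bitPosition+5≤L j (wS j)
      a<L : a < L
      a<L = NP.<-≤-trans (NP.m<m+n a (s≤s z≤n)) a+5≤L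
      a+3<L : a + 3 < L
      a+3<L = NP.<-≤-trans (NP.+-monoʳ-< a (s≤s (s≤s (s≤s (s≤s z≤n))))) a+5≤L
      S-bit-edge : S.adjacent (twin a) (twin (a + 3)) ≡ true
      S-bit-edge = ∨-introˡ {S.labelArc a (a + 3)} (∨-introʳ {(a ≡ᵇ 1) ∧ ((a + 3 ≡ᵇ 6) ∨ (a + 3 ≡ᵇ 8))} (bitArc-at wS 11 j))
      Fa≡a : index (F (twin a)) ≡ a
      Fa≡a = twin-index (10 + x) (NP.≤-trans (NP.≤-reflexive (NP.+-comm 2 a)) (NP.≤-trans (NP.+-monoʳ-≤ a (s≤s (s≤s z≤n))) a+5≤L))
      Fa+3≡a+3 : index (F (twin (a + 3))) ≡ a + 3
      Fa+3≡a+3 = twin-index (10 + x + 3) (NP.<-≤-trans (NP.≤-reflexive (lemma a)) a+5≤L)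
        where
        lemma : ∀ a → suc (suc (a + 3)) ≡ a + 5
        lemma = NatSolver.solve-∀
      read : adjCycle a (a + 3) ≡ true ⊎ T.labelEdge a (a + 3) ≡ true → wT j ≡ wS j
      read (inj₁ cyc) = ⊥-elim (no-cycle-step-3 a cyc)
      read (inj₂ lab) with ∨-true {T.labelArc a (a + 3)} lab
      ... | inj₁ a→a+3 = bitArc-reads wT 11 j (wS j) (T.labelArc-bit (NP.m≤m+n 11 x) a→a+3)
      ... | inj₂ a+3→a = ⊥-elim (no-label-back-by-3 {a} (T.labelArc-shape a+3→a))

  rim-colour : ℕ → Bool × Bool
  rim-colour a = if a ≡ᵇ ℓ + ℓ then (true , false) else (false , even a)

  rim-colour≢hub-colour : ∀ a → rim-colour a ≢ (true , true)
  rim-colour≢hub-colour a with a ≡ᵇ ℓ + ℓ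
  ... | true = λ ()
  ... | false = λ ()

  Separated : ℕ → ℕ → Set
  Separated a b = a ≢ b × (a ≡ ℓ + ℓ ⊎ b ≡ ℓ + ℓ ⊎ even a ≢ even b)

  rim-colour-separates : ∀ {a b} → Separated a b → rim-colour a ≢ rim-colour b
  rim-colour-separates {a} {b} (a≢b , h) with a ≡ᵇ ℓ + ℓ in a-last | b ≡ᵇ ℓ + ℓ in b-last
  ... | true | true = contradiction (trans (≡ᵇ-true⇒≡ a-last) (sym (≡ᵇ-true⇒≡ b-last))) a≢b
  ... | true | false = λ ()
  ... | false | true = λ ()
  ... | false | false = λ same → parity h (cong proj₂ same)
    where
    parity : a ≡ ℓ + ℓ ⊎ b ≡ ℓ + ℓ ⊎ even a ≢ even b → even a ≢ even b
    parity (inj₁ a≡last) = case trans (sym a-last) (≡⇒≡ᵇ-true a≡last) of λ ()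
    parity (inj₂ (inj₁ b≡last)) = case trans (sym b-last) (≡⇒≡ᵇ-true b≡last) of λ ()
    parity (inj₂ (inj₂ even-a≢even-b)) = even-a≢even-b

  arc-separates : ∀ {a b} → arc a b ≡ true → a ≡ ℓ + ℓ ⊎ even a ≢ even b
  arc-separates {a} {b} a→b with suc a ≡ᵇ b in e
  ... | true with refl ← ≡ᵇ-true⇒≡ {suc a} {b} e = inj₂ (not-¬ refl)
  ... | false = inj₁ (NP.suc-injective (≡ᵇ-true⇒≡ (proj₂ (∧-true {b ≡ᵇ 0} a→b))))

  adjCycle-separated : ∀ {a b} → adjCycle a b ≡ true → Separated a b
  adjCycle-separated {a} {b} ab = a≢b , sides (∨-true {arc a b} ab)
    where
    a≢b : a ≢ b
    a≢b refl = case trans (sym ab) (adjCycle-irrefl a) of λ ()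
    sides : arc a b ≡ true ⊎ arc b a ≡ true → a ≡ ℓ + ℓ ⊎ b ≡ ℓ + ℓ ⊎ even a ≢ even b
    sides (inj₁ a→b) with arc-separates {a} {b} a→b
    ... | inj₁ a≡last = inj₁ a≡last
    ... | inj₂ parity = inj₂ (inj₂ parity)
    sides (inj₂ b→a) with arc-separates {b} {a} b→a
    ... | inj₁ b≡last = inj₂ (inj₁ b≡last)
    ... | inj₂ parity = inj₂ (inj₂ (λ e → parity (sym e)))

  colour : Vertex → Bool × Bool
  colour (rim a) = rim-colour a
  colour (twin a) = rim-colour a
  colour (altHub _) = true , true
  colour hub = true , true
  colour pad = false , false

  colour-proper : ∀ w u v → Γ.adjacent w u v ≡ true → colour u ≢ colour v
  colour-proper w (rim a) (rim b) ab = rim-colour-separates {a} {b} (adjCycle-separated ab)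
  colour-proper w (rim a) (twin b) ab = rim-colour-separates {a} {b} (adjCycle-separated ab)
  colour-proper w (twin a) (rim b) ab = rim-colour-separates {a} {b} (adjCycle-separated ab)
  colour-proper w (twin a) (twin b) ab = rim-colour-separates {a} {b} (a≢b , inj₂ (inj₂ (Γ.labelEdge-parity w {a} {b} ab)))
    where
    a≢b : a ≢ b
    a≢b refl = case trans (sym ab) (Γ.labelEdge-irrefl w a) of λ ()
  colour-proper w (rim a) (altHub _) _ = rim-colour≢hub-colour a
  colour-proper w (rim a) hub _ = rim-colour≢hub-colour a
  colour-proper w (twin a) (altHub _) _ = rim-colour≢hub-colour a
  colour-proper w (altHub _) (rim a) _ = rim-colour≢hub-colour a ∘ sym
  colour-proper w (altHub _) (twin a) _ = rim-colour≢hub-colour a ∘ sym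
  colour-proper w hub (rim a) _ = rim-colour≢hub-colour a ∘ sym

-- Realisation on Fin n and counting

module Realisation (m r : ℕ) where
  open Construction m

  n : ℕ
  n = L + (L + (L + suc (suc r)))

  decode : Fin n → Vertex
  decode i with splitAt L i
  ... | inj₁ a = rim (toℕ a)
  ... | inj₂ i₁ with splitAt L i₁
  ...   | inj₁ a = twin (toℕ a)
  ...   | inj₂ i₂ with splitAt L i₂
  ...     | inj₁ a = altHub (toℕ a)
  ...     | inj₂ Fin.zero = hub
  ...     | inj₂ (Fin.suc _) = pad

  decode-valid : ∀ i → Valid (decode i)
  decode-valid i with splitAt L i
  ... | inj₁ a = FP.toℕ<n a
  ... | inj₂ i₁ with splitAt L i₁
  ...   | inj₁ a = FP.toℕ<n a
  ...   | inj₂ i₂ with splitAt L i₂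
  ...     | inj₁ a = FP.toℕ<n a
  ...     | inj₂ Fin.zero = tt
  ...     | inj₂ (Fin.suc _) = tt

  -- Out-of-range indices are sent to 0; they only occur for invalid vertices.
  clamp : ℕ → Fin L
  clamp a with a NP.<? L
  ... | yes a<L = fromℕ< a<L
  ... | no _ = Fin.zero

  toℕ-clamp : ∀ {a} → a < L → toℕ (clamp a) ≡ a
  toℕ-clamp {a} a<L with a NP.<? L
  ... | yes a<L′ = FP.toℕ-fromℕ< a<L′
  ... | no a≮L = contradiction a<L a≮L

  encode : Vertex → Fin n
  encode (rim a) = clamp a ↑ˡ (L + (L + suc (suc r)))
  encode (twin a) = L ↑ʳ (clamp a ↑ˡ (L + suc (suc r)))
  encode (altHub a) = L ↑ʳ (L ↑ʳ (clamp a ↑ˡ suc (suc r)))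
  encode hub = L ↑ʳ (L ↑ʳ (L ↑ʳ Fin.zero))
  encode pad = L ↑ʳ (L ↑ʳ (L ↑ʳ Fin.suc Fin.zero))

  decode-encode : ∀ v → Valid v → decode (encode v) ≡ v
  decode-encode (rim a) a<L
    rewrite FP.splitAt-↑ˡ L (clamp a) (L + (L + suc (suc r))) = cong rim (toℕ-clamp a<L)
  decode-encode (twin a) a<L
    rewrite FP.splitAt-↑ʳ L (L + (L + suc (suc r))) (clamp a ↑ˡ (L + suc (suc r)))
          | FP.splitAt-↑ˡ L (clamp a) (L + suc (suc r)) = cong twin (toℕ-clamp a<L)
  decode-encode (altHub a) a<L
    rewrite FP.splitAt-↑ʳ L (L + (L + suc (suc r))) (L ↑ʳ (clamp a ↑ˡ suc (suc r)))
          | FP.splitAt-↑ʳ L (L + suc (suc r)) (clamp a ↑ˡ suc (suc r))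
          | FP.splitAt-↑ˡ L (clamp a) (suc (suc r)) = cong altHub (toℕ-clamp a<L)
  decode-encode hub _
    rewrite FP.splitAt-↑ʳ L (L + (L + suc (suc r))) (L ↑ʳ (L ↑ʳ Fin.zero {suc r}))
          | FP.splitAt-↑ʳ L (L + suc (suc r)) (L ↑ʳ Fin.zero {suc r})
          | FP.splitAt-↑ʳ L (suc (suc r)) (Fin.zero {suc r}) = refl
  decode-encode pad _
    rewrite FP.splitAt-↑ʳ L (L + (L + suc (suc r))) (L ↑ʳ (L ↑ʳ Fin.suc (Fin.zero {r})))
          | FP.splitAt-↑ʳ L (L + suc (suc r)) (L ↑ʳ Fin.suc (Fin.zero {r}))
          | FP.splitAt-↑ʳ L (suc (suc r)) (Fin.suc (Fin.zero {r})) = refl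

  graph : Word → Graph n
  graph w = record
    { adj = λ i j → Γ.adjacent w (decode i) (decode j)
    ; sym = λ i j → Γ.adjacent-sym w (decode i) (decode j)
    ; irrefl = λ i → Γ.adjacent-irrefl w (decode i)
    }

  adj-encode : ∀ w {u v} → Valid u → Valid v → adj (graph w) (encode u) (encode v) ≡ Γ.adjacent w u v
  adj-encode w {u} {v} u-valid v-valid = cong₂ (Γ.adjacent w) (decode-encode u u-valid) (decode-encode v v-valid)

  hom⇒words-agree : ∀ wS wT → Hom (graph wS) (graph wT) → ∀ j → wS j ≡ wT j
  hom⇒words-agree wS wT (f , f-hom) = Rigidity.words-agree wS wT F F-hom (λ v → decode-valid (f (encode v)))
    where
    F : Vertex → Vertex
    F v = decode (f (encode v))
    F-hom : ∀ u v → Valid u → Valid v → Γ.adjacent wS u v ≡ true → Γ.adjacent wT (F u) (F v) ≡ true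
    F-hom u v u-valid v-valid uv = f-hom (encode u) (encode v) (trans (adj-encode wS u-valid v-valid) uv)

  triangle : ∀ w → Triangle (graph w)
  triangle w = record
    { t₀ = encode hub ; t₁ = encode (rim 0) ; t₂ = encode (rim 1)
    ; t₀t₁ = adj-encode w {hub} {rim 0} tt 0<L
    ; t₀t₂ = adj-encode w {hub} {rim 1} tt 1<L
    ; t₁t₂ = trans (adj-encode w {rim 0} {rim 1} 0<L 1<L) (adjCycle-suc 0)
    }
    where
    0<L : 0 < L
    0<L = small<L 0 _
    1<L : 1 < L
    1<L = small<L 1 _

  TT₂-graphs : ∀ w w′ → TT₂ (graph w) (graph w′)
  TT₂-graphs w w′ = TT₂-into-triangle (graph w) (graph w′) (colour ∘ decode)
    (λ i j → colour-proper w (decode i) (decode j)) (triangle w′)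

funToFin-cong : ∀ {m k} {f g : Fin m → Fin k} → (∀ i → f i ≡ g i) → funToFin f ≡ funToFin g
funToFin-cong {zero} _ = refl
funToFin-cong {suc m} f≗g = cong₂ combine (f≗g Fin.zero) (funToFin-cong (λ i → f≗g (Fin.suc i)))

IncomparableEquivalentFamily : ℕ → ℕ → Set
IncomparableEquivalentFamily n k = Σ (Fin k → Graph n) λ G →
  (∀ i j → ¬ i ≡ j → ¬ Hom (G i) (G j)) × (∀ i j → TT₂-equivalent (G i) (G j))

incomparable-equivalent-family : ∀ m r → IncomparableEquivalentFamily (Realisation.n m r) (2 ^ m)
incomparable-equivalent-family m r = G , incomparable , λ i j → TT₂-graphs _ _ , TT₂-graphs _ _
  where
  open Realisation m r
  G : Fin (2 ^ m) → Graph n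
  G i = graph (finToFun i)
  incomparable : ∀ i j → ¬ i ≡ j → ¬ Hom (G i) (G j)
  incomparable i j i≢j Gi→Gj = i≢j (begin
    i                              ≡⟨ sym (FP.funToFin-finToFin {m} {2} i) ⟩
    funToFin {m} {2} (finToFun i)  ≡⟨ funToFin-cong (hom⇒words-agree (finToFun i) (finToFun j) Gi→Gj) ⟩
    funToFin {m} {2} (finToFun j)  ≡⟨ FP.funToFin-finToFin {m} {2} j ⟩
    j                              ∎)
    where open ≡-Reasoning

record SizeDecomposition (n : ℕ) : Set where
  field
    m r : ℕ
    n≡ : n ≡ Realisation.n m r
    n≤m*48 : n ≤ m * 48

-- m = ⌊(n ∸ 41) / 24⌋ and r is the remainder; 113 ≤ n makes m ≥ 3, whence n ≤ 48 m.
size-decomposition : ∀ n → 113 ≤ n → SizeDecomposition n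
size-decomposition n 113≤n = record { m = m ; r = r ; n≡ = n≡ ; n≤m*48 = n≤m*48 }
  where
  t m r : ℕ
  t = n ∸ 41
  m = t / 24
  r = t % 24
  n≡41+r+m*24 : n ≡ 41 + (r + m * 24)
  n≡41+r+m*24 = trans (sym (NP.m+[n∸m]≡n (NP.≤-trans (NP.m≤m+n 41 72) 113≤n)))
    (cong (λ x → 41 + x) (m≡m%n+[m/n]*n t 24))
  n≡ : n ≡ Realisation.n m r
  n≡ = trans n≡41+r+m*24 (lemma m r)
    where
    lemma : ∀ m r → 41 + (r + m * 24) ≡
      suc (suc (5 + 4 * m) + suc (5 + 4 * m)) + (suc (suc (5 + 4 * m) + suc (5 + 4 * m))
        + (suc (suc (5 + 4 * m) + suc (5 + 4 * m)) + suc (suc r)))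
    lemma = NatSolver.solve-∀
  3≤m : 3 ≤ m
  3≤m = /-monoˡ-≤ 24 (NP.∸-monoˡ-≤ 41 113≤n)
  n≤m*48 : n ≤ m * 48
  n≤m*48 = begin
    n                    ≡⟨ n≡41+r+m*24 ⟩
    41 + (r + m * 24)    ≤⟨ NP.+-monoʳ-≤ 41 (NP.+-monoˡ-≤ (m * 24) (NP.<⇒≤pred (m%n<n t 24))) ⟩
    64 + m * 24          ≤⟨ NP.+-monoˡ-≤ (m * 24) (NP.m≤m+n 64 8) ⟩
    3 * 24 + m * 24      ≤⟨ NP.+-monoˡ-≤ (m * 24) (NP.*-monoˡ-≤ 24 3≤m) ⟩
    m * 24 + m * 24      ≡⟨ lemma m ⟩
    m * 48               ∎
    where
    open NP.≤-Reasoning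
    lemma : ∀ m → m * 24 + m * 24 ≡ m * 48
    lemma = NatSolver.solve-∀

proposition17 : Σ ℕ λ p → Σ ℕ λ q → Σ ℕ λ N → ∀ (n : ℕ) → N ≤ n →
    Σ ℕ λ k → (2 ^ (suc p * n) ≤ k ^ suc q) × Σ (Fin k → Graph n) λ G →
      (∀ (i j : Fin k) → ¬ (i ≡ j) → ¬ Hom (G i) (G j)) ×
      (∀ (i j : Fin k) → TT₂-equivalent (G i) (G j))
proposition17 = 0 , 47 , 113 , families
  where
  families : ∀ n → 113 ≤ n → Σ ℕ λ k → (2 ^ (1 * n) ≤ k ^ 48) × IncomparableEquivalentFamily n k
  families n 113≤n = 2 ^ m , count ,
    subst (λ n → IncomparableEquivalentFamily n (2 ^ m)) (sym n≡) (incomparable-equivalent-family m r)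
    where
    open SizeDecomposition (size-decomposition n 113≤n)
    open NP.≤-Reasoning
    count : 2 ^ (1 * n) ≤ (2 ^ m) ^ 48
    count = begin
      2 ^ (1 * n)   ≡⟨ cong (2 ^_) (NP.*-identityˡ n) ⟩
      2 ^ n         ≤⟨ NP.^-monoʳ-≤ 2 n≤m*48 ⟩
      2 ^ (m * 48)  ≡⟨ NP.^-*-assoc 2 m 48 ⟨
      (2 ^ m) ^ 48  ∎
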